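{- Let $n\ge2$. For $k\ge4$, $t(1,(k-1)n)+1\le t(\mathrm{Wd}(k,n))\le t(1,n)+t(2,k-1)+1$. For $k=3$, $t(1,2n)+1\le t(\mathrm{Wd}(3,n))\le t(1,n)+3$.
   Context: For $k,n\ge2$, the windmill graph $\mathrm{Wd}(k,n)$ is obtained by taking $n$ copies of the complete graph $K_k$ and identifying one vertex from each copy into a single shared vertex; it has $n(k-1)+1$ vertices. For a finite simple graph $G$, a $G$-CFF$(t,|V(G)|)$ is a family of subsets $B_v\subseteq[1,t]=\{1,\dots,t\}$, one for each vertex $v$, such that for every edge $\{a,b\}$: (i) $B_a\not\subseteq B_b$ and $B_b\not\subseteq B_a$, and (ii) for every vertex $w\notin\{a,b\}$, $B_w\not\subseteq B_a\cup B_b$; $t(G)$ is the minimum $t$ for which one exists. $t(1,m)$ is the minimum $t$ such that there exist $m$ subsets of $[1,t]$ none contained in another; equivalently $t(1,m)=\min\{t:\binom{t}{\lfloor t/2\rfloor}\ge m\}$. For $m\ge3$, $t(2,m)$ is the minimum $t$ such that there exist $m$ subsets $B_1,\dots,B_m$ of $[1,t]$ with $B_i\not\subseteq B_j\cup B_l$ for all pairwise distinct $i,j,l$. -}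

module Defs where

open import Level using (0ℓ)
open import Data.Nat using (ℕ; zero; suc; _*_; _≤_; _∸_)
open import Data.Fin using (Fin; zero; suc; remQuot)
open import Data.Fin.Subset using (Subset; _⊆_; _∪_)
open import Data.Product using (Σ; _×_; _,_; proj₁; proj₂)
open import Data.Unit using (⊤; tt)
open import Data.Empty using (⊥)
open import Relation.Nullary using (¬_)
open import Relation.Binary.PropositionalEquality using (_≡_; _≢_; refl) renaming (sym to sym≡)

record Graph : Set₁ where
  field
    order : ℕ
    Adj   : Fin order → Fin order → Set
    irrefl : ∀ v → ¬ Adj v v
    sym    : ∀ {a b} → Adj a b → Adj b a

IsGCFF : (G : Graph) (t : ℕ) → (Fin (Graph.order G) → Subset t) → Set
IsGCFF G t B = ∀ a b → Graph.Adj G a b →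
    (¬ (B a ⊆ B b)) × (¬ (B b ⊆ B a)) ×
    (∀ w → w ≢ a → w ≢ b → ¬ (B w ⊆ (B a ∪ B b)))

HasGCFF : Graph → ℕ → Set
HasGCFF G t = Σ (Fin (Graph.order G) → Subset t) (IsGCFF G t)

Has1CFF : ℕ → ℕ → Set
Has1CFF m t = Σ (Fin m → Subset t) λ B → ∀ i j → i ≢ j → ¬ (B i ⊆ B j)

Has2CFF : ℕ → ℕ → Set
Has2CFF m t = Σ (Fin m → Subset t) λ B →
  ∀ i j l → i ≢ j → i ≢ l → j ≢ l → ¬ (B i ⊆ (B j ∪ B l))

IsMin : (ℕ → Set) → ℕ → Set
IsMin P t = P t × (∀ s → P s → t ≤ s)

-- Windmill graph Wd(k,n) on vertex set Fin (1 + n(k-1)):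
-- vertex zero is the shared centre; vertex suc x with remQuot (k-1) x = (i , a)
-- is the a-th non-centre vertex of the i-th copy of K_k.
WdAdj : (k n : ℕ) → Fin (suc (n * (k ∸ 1))) → Fin (suc (n * (k ∸ 1))) → Set
WdAdj k n zero zero = ⊥
WdAdj k n zero (suc _) = ⊤
WdAdj k n (suc _) zero = ⊤
WdAdj k n (suc x) (suc y) =
  (proj₁ (remQuot {n} (k ∸ 1) x) ≡ proj₁ (remQuot {n} (k ∸ 1) y)) ×
  (proj₂ (remQuot {n} (k ∸ 1) x) ≢ proj₂ (remQuot {n} (k ∸ 1) y))

WdAdj-irrefl : (k n : ℕ) → ∀ v → ¬ WdAdj k n v v
WdAdj-irrefl k n zero ()
WdAdj-irrefl k n (suc x) (_ , ne) = ne refl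

WdAdj-sym : (k n : ℕ) → ∀ {a b} → WdAdj k n a b → WdAdj k n b a
WdAdj-sym k n {zero} {suc _} _ = tt
WdAdj-sym k n {suc _} {zero} _ = tt
WdAdj-sym k n {suc _} {suc _} (e , ne) = sym≡ e , λ q → ne (sym≡ q)

Wd : ℕ → ℕ → Graph
Wd k n = record
  { order = suc (n * (k ∸ 1))
  ; Adj = WdAdj k n
  ; irrefl = WdAdj-irrefl k n
  ; sym = WdAdj-sym k n
  }

-- A dominating vertex c forces an extra point: the set of c contains some point p, and the
-- set of any other vertex avoids the union of the set of c with the set of any third
-- vertex, so deleting p from the sets of all vertices other than c leaves |V| - 1 pairwise
-- incomparable sets on t - 1 points.
--
-- Conversely, let C be an antichain of n subsets of [1,b] and D a 2-CFF of k - 1 subsets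
-- of [1,c] that is also an antichain (automatic once k - 1 ≥ 3). Give the centre of
-- Wd(k,n) a fresh point and the j-th non-centre vertex of the i-th copy the set C i ++ D j.
-- A vertex of a different copy is separated by its C-part, one of the same copy by its
-- D-part. For k = 3 the two singletons of [1,2] serve as D.
module Submission where

open import Defs
open import Data.Nat using (ℕ; zero; suc; pred; _+_; _*_; _∸_; _≤_; _≥_; s≤s; z≤n)
open import Data.Nat.Properties using (+-comm; +-suc; *-comm; ≤-trans)
open import Data.Bool using (true; false)
open import Data.Fin using (Fin; zero; suc; remQuot; combine; punchIn; punchOut)
open import Data.Fin.Properties using (combine-remQuot; punchIn-injective; punchInᵢ≢i; ¬∀⟶∃¬)
  renaming (_≟_ to _≟ᶠ_)
open import Data.Fin.Subset using (Subset; _⊆_; _∪_; _∈_; _∉_; ⊥)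
open import Data.Fin.Subset.Properties
  using (_∈?_; drop-∷-⊆; ⊥⊆; ⊆-trans; p⊆p∪q; x∈p∪q⁺; ∪-identityˡ; ∪-idem; ∪-comm)
open import Data.Vec using ([]; _∷_; _++_; removeAt)
open import Data.Vec.Properties using (zipWith-++; removeAt-punchOut; []=⇒lookup; lookup⇒[]=)
open import Data.Vec.Base using (here; there)
open import Data.Product using (∃; _×_; _,_; proj₁; proj₂)
open import Data.Sum using (inj₁; inj₂)
open import Data.Unit using (tt)
open import Data.Empty using (⊥-elim)
open import Relation.Nullary using (¬_; yes; no; _→-dec_; contradiction)
open import Relation.Binary.PropositionalEquality
  using (_≡_; _≢_; refl; sym; trans; cong; cong₂; subst; module ≡-Reasoning)
open import Function using (_∘_)

IsAntichain : ∀ {m t} → (Fin m → Subset t) → Set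
IsAntichain B = ∀ i j → i ≢ j → ¬ (B i ⊆ B j)

Is2CFF : ∀ {m t} → (Fin m → Subset t) → Set
Is2CFF B = ∀ i j l → i ≢ j → i ≢ l → j ≢ l → ¬ (B i ⊆ (B j ∪ B l))

IsDominating : (G : Graph) → Fin (Graph.order G) → Set
IsDominating G c = ∀ v → v ≢ c → Graph.Adj G c v

⊈⇒∃∉ : ∀ {t} {p q : Subset t} → ¬ (p ⊆ q) → ∃ λ x → x ∈ p × x ∉ q
⊈⇒∃∉ {t} {p} {q} p⊈q with ¬∀⟶∃¬ t _ (λ x → x ∈? p →-dec x ∈? q) (λ p⊆q → p⊈q (p⊆q _))
... | x , x∈p⇏x∈q with x ∈? p
...   | yes x∈p = x , x∈p , λ x∈q → x∈p⇏x∈q (λ _ → x∈q)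
...   | no  x∉p = contradiction (λ x∈p → contradiction x∈p x∉p) x∈p⇏x∈q

∈-removeAt⁺ : ∀ {t} {p : Subset (suc t)} {s x} (s≢x : s ≢ x) → x ∈ p → punchOut s≢x ∈ removeAt p s
∈-removeAt⁺ {p = p} s≢x x∈p = lookup⇒[]= _ _ (trans (removeAt-punchOut p s≢x) ([]=⇒lookup x∈p))

∈-removeAt⁻ : ∀ {t} {p : Subset (suc t)} {s x} (s≢x : s ≢ x) → punchOut s≢x ∈ removeAt p s → x ∈ p
∈-removeAt⁻ {p = p} s≢x x∈p = lookup⇒[]= _ _ (trans (sym (removeAt-punchOut p s≢x)) ([]=⇒lookup x∈p))

removeAt-antichain : ∀ {m t} {S : Subset (suc t)} {s} → s ∈ S → (F : Fin m → Subset (suc t)) →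
                     (∀ i j → i ≢ j → ¬ (F i ⊆ (S ∪ F j))) →
                     IsAntichain (λ i → removeAt (F i) s)
removeAt-antichain {s = s} s∈S F F-separated i j i≢j Fᵢ-s⊆Fⱼ-s
  with ⊈⇒∃∉ (F-separated i j i≢j)
... | x , x∈Fᵢ , x∉S∪Fⱼ = x∉S∪Fⱼ (x∈p∪q⁺ (inj₂ x∈Fⱼ))
  where
  s≢x : s ≢ x
  s≢x refl = x∉S∪Fⱼ (x∈p∪q⁺ (inj₁ s∈S))
  x∈Fⱼ : x ∈ F j
  x∈Fⱼ = ∈-removeAt⁻ s≢x (Fᵢ-s⊆Fⱼ-s (∈-removeAt⁺ s≢x x∈Fᵢ))

++-⊆⁻ : ∀ {b c} {p q : Subset b} {p′ q′ : Subset c} → (p ++ p′) ⊆ (q ++ q′) → (p ⊆ q) × (p′ ⊆ q′)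
++-⊆⁻ {p = []} {[]} h = (λ ()) , h
++-⊆⁻ {p = x ∷ p} {y ∷ q} {p′} {q′} h = head⊆ , proj₂ tail⊆
  where
  tail⊆ : (p ⊆ q) × (p′ ⊆ q′)
  tail⊆ = ++-⊆⁻ (drop-∷-⊆ h)
  head⊆ : (x ∷ p) ⊆ (y ∷ q)
  head⊆ here with h here
  ... | here = here
  head⊆ (there z∈p) = there (proj₁ tail⊆ z∈p)

⊥-++ : ∀ b c → ⊥ {b + c} ≡ ⊥ {b} ++ ⊥ {c}
⊥-++ zero    c = refl
⊥-++ (suc b) c = cong (false ∷_) (⊥-++ b c)

¬inside⊆outside : ∀ {t} {p q : Subset t} → ¬ ((true ∷ p) ⊆ (false ∷ q))
¬inside⊆outside h with h here
... | ()

antichain⇒nonempty : ∀ {m t} {D : Fin (suc (suc m)) → Subset t} → IsAntichain D → ∀ a → ¬ (D a ⊆ ⊥)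
antichain⇒nonempty anti zero    D⊆⊥ = anti zero (suc zero) (λ ()) (⊆-trans D⊆⊥ ⊥⊆)
antichain⇒nonempty anti (suc a) D⊆⊥ = anti (suc a) zero (λ ()) (⊆-trans D⊆⊥ ⊥⊆)

avoid-two : ∀ {m} (a a′ : Fin (suc (suc (suc m)))) → ∃ λ l → a ≢ l × a′ ≢ l
avoid-two zero          zero          = suc zero , (λ ()) , (λ ())
avoid-two zero          (suc zero)    = suc (suc zero) , (λ ()) , (λ ())
avoid-two zero          (suc (suc _)) = suc zero , (λ ()) , (λ ())
avoid-two (suc zero)    zero          = suc (suc zero) , (λ ()) , (λ ())
avoid-two (suc (suc _)) zero          = suc zero , (λ ()) , (λ ())
avoid-two (suc _)       (suc _)       = zero , (λ ()) , (λ ())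

2CFF⇒antichain : ∀ {m t} {D : Fin (suc (suc (suc m))) → Subset t} → Is2CFF D → IsAntichain D
2CFF⇒antichain {D = D} cff a a′ a≢a′ Dₐ⊆Dₐ′ with avoid-two a a′
... | l , a≢l , a′≢l = cff a a′ l a≢a′ a≢l a′≢l (⊆-trans Dₐ⊆Dₐ′ (p⊆p∪q (D l)))

Fin2-Is2CFF : ∀ {t} (D : Fin 2 → Subset t) → Is2CFF D
Fin2-Is2CFF D zero       zero       _          i≢j _   _   _ = i≢j refl
Fin2-Is2CFF D (suc zero) (suc zero) _          i≢j _   _   _ = i≢j refl
Fin2-Is2CFF D zero       (suc zero) zero       _   i≢l _   _ = i≢l refl
Fin2-Is2CFF D (suc zero) zero       (suc zero) _   i≢l _   _ = i≢l refl
Fin2-Is2CFF D zero       (suc zero) (suc zero) _   _   j≢l _ = j≢l refl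
Fin2-Is2CFF D (suc zero) zero       zero       _   _   j≢l _ = j≢l refl

singletons₂ : Fin 2 → Subset 2
singletons₂ zero       = true ∷ false ∷ []
singletons₂ (suc zero) = false ∷ true ∷ []

singletons₂-antichain : IsAntichain singletons₂
singletons₂-antichain zero       zero       i≢j _ = i≢j refl
singletons₂-antichain (suc zero) (suc zero) i≢j _ = i≢j refl
singletons₂-antichain zero       (suc zero) _   h with h here
... | ()
singletons₂-antichain (suc zero) zero       _   h with h (there here)
... | there ()

¬HasGCFF-0 : (G : Graph) {a b : Fin (Graph.order G)} → Graph.Adj G a b → ¬ HasGCFF G 0
¬HasGCFF-0 G a~b (B , gcff) = proj₁ (gcff _ _ a~b) λ {()}

dominating⇒Has1CFF : (G : Graph) (c : Fin (Graph.order G)) → IsDominating G c →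
                     (v₀ : Fin (Graph.order G)) → v₀ ≢ c →
                     ∀ {t} → HasGCFF G (suc t) → Has1CFF (pred (Graph.order G)) t
dominating⇒Has1CFF record { order = zero } ()
dominating⇒Has1CFF record { order = suc N } c dom v₀ v₀≢c (B , gcff)
  with ⊈⇒∃∉ (proj₁ (gcff c v₀ (dom v₀ v₀≢c)))
... | p , p∈Bc , _ = _ , removeAt-antichain p∈Bc (B ∘ punchIn c) separated
  where
  separated : ∀ i j → i ≢ j → ¬ (B (punchIn c i) ⊆ (B c ∪ B (punchIn c j)))
  separated i j i≢j = proj₂ (proj₂ (gcff c (punchIn c j) (dom _ (punchInᵢ≢i c j))))
                        (punchIn c i) (punchInᵢ≢i c i) (i≢j ∘ punchIn-injective c i j)

dominating-lowerBound : (G : Graph) (c : Fin (Graph.order G)) → IsDominating G c →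
                        (v₀ : Fin (Graph.order G)) → v₀ ≢ c →
                        ∀ {tG a} → IsMin (HasGCFF G) tG → IsMin (Has1CFF (pred (Graph.order G))) a →
                        a + 1 ≤ tG
dominating-lowerBound G c dom v₀ v₀≢c {zero} (G-cff , _) _ =
  ⊥-elim (¬HasGCFF-0 G (dom v₀ v₀≢c) G-cff)
dominating-lowerBound G c dom v₀ v₀≢c {suc t} {a} (G-cff , _) (_ , a-min) =
  subst (_≤ suc t) (+-comm 1 a) (s≤s (a-min t (dominating⇒Has1CFF G c dom v₀ v₀≢c G-cff)))

Wd-lowerBound : ∀ {k n tW a} → k ≥ 2 → n ≥ 1 →
                IsMin (HasGCFF (Wd k n)) tW → IsMin (Has1CFF ((k ∸ 1) * n)) a → a + 1 ≤ tW
Wd-lowerBound {suc (suc k)} {suc n} {a = a} (s≤s (s≤s _)) (s≤s _) tW-min a-min =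
  dominating-lowerBound (Wd (suc (suc k)) (suc n)) zero centre-dominating (suc zero) (λ ()) tW-min
    (subst (λ m → IsMin (Has1CFF m) a) (*-comm (suc k) (suc n)) a-min)
  where
  centre-dominating : IsDominating (Wd (suc (suc k)) (suc n)) zero
  centre-dominating zero    0≢0 = 0≢0 refl
  centre-dominating (suc _) _   = tt

Separates : ∀ {N t} → (Fin N → Subset t) → Fin N → Fin N → Set
Separates B a b =
  (¬ (B a ⊆ B b)) × (¬ (B b ⊆ B a)) × (∀ w → w ≢ a → w ≢ b → ¬ (B w ⊆ (B a ∪ B b)))

Separates-sym : ∀ {N t} {B : Fin N → Subset t} {a b} → Separates B a b → Separates B b a
Separates-sym {B = B} {a} {b} (a⊈b , b⊈a , w⊈a∪b) =
  b⊈a , a⊈b , λ w w≢b w≢a w⊆b∪a → w⊈a∪b w w≢a w≢b (subst (B w ⊆_) (∪-comm (B b) (B a)) w⊆b∪a)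

Wd-HasGCFF : ∀ {n m b c} {C : Fin n → Subset b} {D : Fin (suc (suc m)) → Subset c} →
             IsAntichain C → IsAntichain D → Is2CFF D →
             HasGCFF (Wd (suc (suc (suc m))) n) (suc (b + c))
Wd-HasGCFF {n} {m} {b} {c} {C} {D} C-anti D-anti D-2cff = B , gcff
  where
  copy : Fin (n * suc (suc m)) → Fin n
  copy x = proj₁ (remQuot {n} (suc (suc m)) x)

  slot : Fin (n * suc (suc m)) → Fin (suc (suc m))
  slot x = proj₂ (remQuot {n} (suc (suc m)) x)

  copy-slot-injective : ∀ {x y} → copy x ≡ copy y → slot x ≡ slot y → x ≡ y
  copy-slot-injective {x} {y} copy≡ slot≡ = begin
    x                         ≡⟨ combine-remQuot {n} (suc (suc m)) x ⟨
    combine (copy x) (slot x) ≡⟨ cong₂ combine copy≡ slot≡ ⟩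
    combine (copy y) (slot y) ≡⟨ combine-remQuot {n} (suc (suc m)) y ⟩
    y                         ∎
    where open ≡-Reasoning

  V : Fin (n * suc (suc m)) → Subset (b + c)
  V x = C (copy x) ++ D (slot x)

  B : Fin (suc (n * suc (suc m))) → Subset (suc (b + c))
  B zero    = true ∷ ⊥
  B (suc x) = false ∷ V x

  V-antichain : IsAntichain V
  V-antichain x y x≢y Vx⊆Vy with copy x ≟ᶠ copy y
  ... | no  copy≢ = C-anti _ _ copy≢ (proj₁ (++-⊆⁻ Vx⊆Vy))
  ... | yes copy≡ = D-anti _ _ (x≢y ∘ copy-slot-injective copy≡) (proj₂ (++-⊆⁻ Vx⊆Vy))

  V-nonempty : ∀ x → ¬ (V x ⊆ ⊥)
  V-nonempty x Vx⊆⊥ =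
    antichain⇒nonempty D-anti (slot x) (proj₂ (++-⊆⁻ (subst (V x ⊆_) (⊥-++ b c) Vx⊆⊥)))

  hub-separates : ∀ y → Separates B zero (suc y)
  hub-separates y = ¬inside⊆outside , V-nonempty y ∘ drop-∷-⊆ , others
    where
    others : ∀ w → w ≢ zero → w ≢ suc y → ¬ (B w ⊆ (B zero ∪ B (suc y)))
    others zero    w≢0 _ = contradiction refl w≢0
    others (suc z) _ z≢y h =
      V-antichain z y (z≢y ∘ cong suc) (subst (V z ⊆_) (∪-identityˡ (V y)) (drop-∷-⊆ h))

  blade-separates : ∀ x y → copy x ≡ copy y → slot x ≢ slot y → Separates B (suc x) (suc y)
  blade-separates x y copy≡ slot≢ =
    V-antichain x y (slot≢ ∘ cong slot) ∘ drop-∷-⊆ ,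
    V-antichain y x (slot≢ ∘ sym ∘ cong slot) ∘ drop-∷-⊆ ,
    others
    where
    others : ∀ w → w ≢ suc x → w ≢ suc y → ¬ (B w ⊆ (B (suc x) ∪ B (suc y)))
    others zero    _ _ h = ¬inside⊆outside h
    others (suc z) z≢x z≢y h
      with ++-⊆⁻ (subst (V z ⊆_) (zipWith-++ _ (C (copy x)) (D (slot x)) (C (copy y)) (D (slot y))) (drop-∷-⊆ h))
         | copy z ≟ᶠ copy x
    ... | Cz⊆ , _ | no copy≢ =
      C-anti _ _ copy≢ (subst (C (copy z) ⊆_) (trans (cong (λ i → C (copy x) ∪ C i) (sym copy≡)) (∪-idem _)) Cz⊆)
    ... | _ , Dz⊆ | yes copy≡′ =
      D-2cff _ _ _ (z≢x ∘ cong suc ∘ copy-slot-injective copy≡′)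
                   (z≢y ∘ cong suc ∘ copy-slot-injective (trans copy≡′ copy≡)) slot≢ Dz⊆

  gcff : IsGCFF (Wd (suc (suc (suc m))) n) (suc (b + c)) B
  gcff zero    zero    ()
  gcff zero    (suc y) _                = hub-separates y
  gcff (suc x) zero    _                = Separates-sym (hub-separates x)
  gcff (suc x) (suc y) (copy≡ , slot≢) = blade-separates x y copy≡ slot≢

Wd-upperBound : ∀ {k n b c} → k ≥ 4 → Has1CFF n b → Has2CFF (k ∸ 1) c → HasGCFF (Wd k n) (b + c + 1)
Wd-upperBound {k@(suc (suc (suc (suc _))))} {n} (s≤s (s≤s (s≤s (s≤s _)))) (_ , C-anti) (_ , D-2cff) =
  subst (HasGCFF (Wd k n)) (+-comm 1 _) (Wd-HasGCFF C-anti (2CFF⇒antichain D-2cff) D-2cff)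

Wd₃-upperBound : ∀ {n b} → Has1CFF n b → HasGCFF (Wd 3 n) (b + 3)
Wd₃-upperBound {n} {b} (_ , C-anti) =
  subst (HasGCFF (Wd 3 n)) (sym (+-suc b 2)) (Wd-HasGCFF C-anti singletons₂-antichain (Fin2-Is2CFF singletons₂))

theorem7p4 : ∀ (n : ℕ) → n ≥ 2 →
    (∀ (k tW a b c : ℕ) → k ≥ 4 →
      IsMin (HasGCFF (Wd k n)) tW →
      IsMin (Has1CFF ((k ∸ 1) * n)) a →
      IsMin (Has1CFF n) b →
      IsMin (Has2CFF (k ∸ 1)) c →
      (a + 1 ≤ tW) × (tW ≤ b + c + 1))
    ×
    (∀ (tW a b : ℕ) →
      IsMin (HasGCFF (Wd 3 n)) tW →
      IsMin (Has1CFF (2 * n)) a →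
      IsMin (Has1CFF n) b →
      (a + 1 ≤ tW) × (tW ≤ b + 3))
theorem7p4 n n≥2 =
  (λ { k tW a b c k≥4 tW-min a-min (b-cff , _) (c-cff , _) →
         Wd-lowerBound (≤-trans (s≤s (s≤s z≤n)) k≥4) n≥1 tW-min a-min
       , proj₂ tW-min _ (Wd-upperBound k≥4 b-cff c-cff) }) ,
  (λ { tW a b tW-min a-min (b-cff , _) →
         Wd-lowerBound (s≤s (s≤s z≤n)) n≥1 tW-min a-min
       , proj₂ tW-min _ (Wd₃-upperBound b-cff) })
  where
  n≥1 : n ≥ 1
  n≥1 = ≤-trans (s≤s z≤n) n≥2
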